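{- Let $P_1$, $P_2$ be iposets with $\mathrm{tgt}(P_1)=\mathrm{src}(P_2)$ and $P=P_1\ast P_2$. The gluing $P=P_1\ast P_2$ is trivial (i.e. $P=P_1$ or $P=P_2$ as posets) if and only if $P_1$ is a starter or $P_2$ is a terminator.
   Context: A poset is a finite set with an irreflexive transitive relation $<$; $P^{\min}$, $P^{\max}$ are its sets of minimal and maximal elements. Let $[n]=\{1,\dots,n\}$ ($[0]=\emptyset$). An iposet $(s,P,t):n\to m$ is a poset $P$ with injective maps $s:[n]\to P$, $t:[m]\to P$ with $s([n])\subseteq P^{\min}$, $t([m])\subseteq P^{\max}$; $\mathrm{src}(P)=n$, $\mathrm{tgt}(P)=m$. For $(s_1,P_1,t_1):n_1\to m_1$ and $(s_2,P_2,t_2):m_1\to m_2$, the gluing $P_1\ast P_2:n_1\to m_2$ has carrier the quotient of the disjoint union $P_1\sqcup P_2$ identifying $(t_1(k),1)$ with $(s_2(k),2)$ for each $k\in[m_1]$, order $(p,i)<(q,j)$ iff ($i=j$ and $p<_iq$) or ($i<j$, $p\notin t_1([m_1])$, $q\notin s_2([m_1])$), source map induced by $s_1$ and target map induced by $t_2$. An iposet $(s,P,t)$ is discrete if $P$ has empty order; a starter if it is discrete and $t$ is bijective; a terminator if it is discrete and $s$ is bijective. -}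

module Defs where

open import Data.Nat using (ℕ)
open import Data.Fin using (Fin)
open import Data.Sum using (_⊎_; inj₁; inj₂)
open import Data.Product using (Σ; ∃; ∃-syntax; _×_; _,_)
open import Data.Empty using (⊥)
open import Relation.Nullary using (¬_)
open import Relation.Binary.PropositionalEquality using (_≡_)

record Iposet (n m : ℕ) : Set₁ where
  field
    size    : ℕ
    _<_     : Fin size → Fin size → Set
    irrefl  : ∀ p → ¬ (p < p)
    trans   : ∀ {p q r} → p < q → q < r → p < r
    s       : Fin n → Fin size
    t       : Fin m → Fin size
    s-inj   : ∀ i j → s i ≡ s j → i ≡ j
    t-inj   : ∀ i j → t i ≡ t j → i ≡ j
    s-min   : ∀ i p → ¬ (p < s i)
    t-max   : ∀ i p → ¬ (t i < p)

open Iposet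

InSrc : ∀ {n m} (P : Iposet n m) → Fin (size P) → Set
InSrc P p = ∃[ k ] (s P k ≡ p)

InTgt : ∀ {n m} (P : Iposet n m) → Fin (size P) → Set
InTgt P p = ∃[ k ] (t P k ≡ p)

Discrete : ∀ {n m} → Iposet n m → Set
Discrete P = ∀ p q → ¬ (_<_ P p q)

-- bijective = injective (built into Iposet) and surjective
Starter : ∀ {n m} → Iposet n m → Set
Starter P = Discrete P × (∀ p → InTgt P p)

Terminator : ∀ {n m} → Iposet n m → Set
Terminator P = Discrete P × (∀ p → InSrc P p)

-- Gluing P₁ * P₂ : carrier is the quotient of Fin size₁ ⊎ Fin size₂ by
-- (t₁ k , 1) ~ (s₂ k , 2); we present it as a setoid.

module Glue {n m l : ℕ} (P₁ : Iposet n m) (P₂ : Iposet m l) where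

  Carrier : Set
  Carrier = Fin (size P₁) ⊎ Fin (size P₂)

  -- the equivalence relation generated by the identifications
  -- (t₁,s₂ injective, so classes have at most two elements)
  data _≈_ : Carrier → Carrier → Set where
    refl≈  : ∀ {x} → x ≈ x
    glue   : ∀ k → inj₁ (t P₁ k) ≈ inj₂ (s P₂ k)
    glue˘  : ∀ k → inj₂ (s P₂ k) ≈ inj₁ (t P₁ k)

  Base : Carrier → Carrier → Set
  Base (inj₁ p) (inj₁ q) = _<_ P₁ p q
  Base (inj₂ p) (inj₂ q) = _<_ P₂ p q
  Base (inj₁ p) (inj₂ q) = ¬ InTgt P₁ p × ¬ InSrc P₂ q
  Base (inj₂ p) (inj₁ q) = ⊥

  _<G_ : Carrier → Carrier → Set
  x <G y = ∃[ x' ] ∃[ y' ] (x ≈ x' × y ≈ y' × Base x' y')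

  ι₁ : Fin (size P₁) → Carrier
  ι₁ = inj₁

  ι₂ : Fin (size P₂) → Carrier
  ι₂ = inj₂

  IsoVia : {k : ℕ} → (Fin k → Fin k → Set) → (Fin k → Carrier) → Set
  IsoVia _≺_ f =
      (∀ p q → f p ≈ f q → p ≡ q)
    × (∀ x → ∃[ p ] (f p ≈ x))
    × (∀ p q → (p ≺ q → f p <G f q) × (f p <G f q → p ≺ q))

  Trivial : Set
  Trivial = IsoVia (_<_ P₁) ι₁ ⊎ IsoVia (_<_ P₂) ι₂

{-# OPTIONS --safe #-}
-- In P₁ * P₂ every point of P₂ outside s₂ sits strictly above every point of
-- P₁ outside t₁, and points of s₂ (resp. t₁) are only identified, never
-- ordered across.  So ι₁ and ι₂ are always order embeddings, and the gluing
-- collapses to P₁ (resp. P₂) exactly when s₂ (resp. t₁) is onto.  A surjective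
-- source map forces discreteness, since its image consists of minimal points.
module Submission where

open import Defs
open import Data.Nat using (ℕ)
open import Data.Sum using (_⊎_; inj₁; inj₂)
open import Data.Product using (_×_; _,_; ∃-syntax)
open import Data.Empty using (⊥-elim)
open import Relation.Binary.PropositionalEquality using (_≡_; refl)
open Iposet

module _ {n m : ℕ} (P : Iposet n m) where

  surjective-s⇒Terminator : (∀ p → InSrc P p) → Terminator P
  surjective-s⇒Terminator src = discrete , src
    where
    discrete : Discrete P
    discrete p q p<q with src q
    ... | k , refl = s-min P k p p<q

  surjective-t⇒Starter : (∀ p → InTgt P p) → Starter P
  surjective-t⇒Starter tgt = discrete , tgt
    where
    discrete : Discrete P
    discrete p q p<q with tgt p
    ... | k , refl = t-max P k q p<q

module _ {n m l : ℕ} (P₁ : Iposet n m) (P₂ : Iposet m l) where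
  open Glue P₁ P₂

  ι₁-injective : ∀ p q → ι₁ p ≈ ι₁ q → p ≡ q
  ι₁-injective p .p refl≈ = refl

  ι₂-injective : ∀ p q → ι₂ p ≈ ι₂ q → p ≡ q
  ι₂-injective p .p refl≈ = refl

  ι₁-mono : ∀ {p q} → _<_ P₁ p q → ι₁ p <G ι₁ q
  ι₁-mono {p} {q} p<q = ι₁ p , ι₁ q , refl≈ , refl≈ , p<q

  ι₂-mono : ∀ {p q} → _<_ P₂ p q → ι₂ p <G ι₂ q
  ι₂-mono {p} {q} p<q = ι₂ p , ι₂ q , refl≈ , refl≈ , p<q

  ι₁-reflects : ∀ {p q} → ι₁ p <G ι₁ q → _<_ P₁ p q
  ι₁-reflects (_ , _ , refl≈  , refl≈   , p<q)     = p<q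
  ι₁-reflects (_ , _ , refl≈  , glue k  , (_ , q∉s₂)) = ⊥-elim (q∉s₂ (k , refl))
  ι₁-reflects (_ , _ , glue _ , glue k  , s<s)     = ⊥-elim (s-min P₂ k _ s<s)
  ι₁-reflects (_ , _ , glue _ , refl≈   , ())

  ι₂-reflects : ∀ {p q} → ι₂ p <G ι₂ q → _<_ P₂ p q
  ι₂-reflects (_ , _ , refl≈   , refl≈  , p<q)        = p<q
  ι₂-reflects (_ , _ , glue˘ k , refl≈  , (p∉t₁ , _)) = ⊥-elim (p∉t₁ (k , refl))
  ι₂-reflects (_ , _ , glue˘ k , glue˘ _ , t<t)       = ⊥-elim (t-max P₁ k _ t<t)
  ι₂-reflects (_ , _ , refl≈   , glue˘ _ , ())

  ι₁-surjective⇒surjective-s₂ : (∀ x → ∃[ p ] (ι₁ p ≈ x)) → ∀ q → InSrc P₂ q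
  ι₁-surjective⇒surjective-s₂ onto q with onto (ι₂ q)
  ... | _ , glue k = k , refl

  ι₂-surjective⇒surjective-t₁ : (∀ x → ∃[ q ] (ι₂ q ≈ x)) → ∀ p → InTgt P₁ p
  ι₂-surjective⇒surjective-t₁ onto p with onto (ι₁ p)
  ... | _ , glue˘ k = k , refl

  surjective-s₂⇒ι₁-surjective : (∀ q → InSrc P₂ q) → ∀ x → ∃[ p ] (ι₁ p ≈ x)
  surjective-s₂⇒ι₁-surjective src (inj₁ p) = p , refl≈
  surjective-s₂⇒ι₁-surjective src (inj₂ q) with src q
  ... | k , refl = t P₁ k , glue k

  surjective-t₁⇒ι₂-surjective : (∀ p → InTgt P₁ p) → ∀ x → ∃[ q ] (ι₂ q ≈ x)
  surjective-t₁⇒ι₂-surjective tgt (inj₂ q) = q , refl≈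
  surjective-t₁⇒ι₂-surjective tgt (inj₁ p) with tgt p
  ... | k , refl = s P₂ k , glue˘ k

  surjective-s₂⇒IsoVia-ι₁ : (∀ q → InSrc P₂ q) → IsoVia (_<_ P₁) ι₁
  surjective-s₂⇒IsoVia-ι₁ src =
    ι₁-injective , surjective-s₂⇒ι₁-surjective src , λ _ _ → ι₁-mono , ι₁-reflects

  surjective-t₁⇒IsoVia-ι₂ : (∀ p → InTgt P₁ p) → IsoVia (_<_ P₂) ι₂
  surjective-t₁⇒IsoVia-ι₂ tgt =
    ι₂-injective , surjective-t₁⇒ι₂-surjective tgt , λ _ _ → ι₂-mono , ι₂-reflects

lemma3 : {n m l : ℕ} (P₁ : Iposet n m) (P₂ : Iposet m l) →
    (Glue.Trivial P₁ P₂ → Starter P₁ ⊎ Terminator P₂) ×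
    (Starter P₁ ⊎ Terminator P₂ → Glue.Trivial P₁ P₂)
lemma3 P₁ P₂ = trivial⇒ , ⇒trivial
  where
  trivial⇒ : Glue.Trivial P₁ P₂ → Starter P₁ ⊎ Terminator P₂
  trivial⇒ (inj₁ (_ , onto , _)) =
    inj₂ (surjective-s⇒Terminator P₂ (ι₁-surjective⇒surjective-s₂ P₁ P₂ onto))
  trivial⇒ (inj₂ (_ , onto , _)) =
    inj₁ (surjective-t⇒Starter P₁ (ι₂-surjective⇒surjective-t₁ P₁ P₂ onto))

  ⇒trivial : Starter P₁ ⊎ Terminator P₂ → Glue.Trivial P₁ P₂
  ⇒trivial (inj₁ (_ , tgt)) = inj₂ (surjective-t₁⇒IsoVia-ι₂ P₁ P₂ tgt)
  ⇒trivial (inj₂ (_ , src)) = inj₁ (surjective-s₂⇒IsoVia-ι₁ P₁ P₂ src)
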